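{- Let $k\ge1$ and let $F_n^k(\mathbf z;q)=\sum_{\pi\in LP_n^k}\big(\prod_j z_{\ell_j}\big)q^{\mathrm{inv}(\pi)}$ as in the context (and similarly $F_n^{k-1}(\mathbf z;q)$ with $LP_n^{k-1}$). Then for all $m\ge1$, $n\ge1$, $$F_{m+n}^k(\mathbf z;q)=q^{mn}F_m^k(\mathbf z;q)F_n^k(\mathbf z;q)+\sum_{i=2}^k\sum_{j=1}^{i-1}z_i\,q^{i(n-i+j)}q^{(m-j)(n+j)}F_{m-j}^k(\mathbf z;q)F_{n-i+j}^k(\mathbf z;q),$$ and for all $n\ge1$, $$F_n^k(\mathbf z;q)=F_n^{k-1}(\mathbf z;q)+\sum_{j=0}^{n-k}z_k\,q^{k(n-k-j)}q^{j(n-j)}F_j^{k-1}(\mathbf z;q)F_{n-k-j}^k(\mathbf z;q).$$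
   Context: For a composition $(\ell_1,\dots,\ell_r)$ of $n$, the associated layered permutation of $[n]$ is the word whose first $\ell_1$ entries are the $\ell_1$ largest elements of $[n]$ in increasing order, next $\ell_2$ entries the next $\ell_2$ largest elements in increasing order, and so on; these blocks are its layers. For $K\ge0$, $LP_n^K$ is the set of layered permutations of $[n]$ all of whose layers have length at most $K$. For indeterminates $\mathbf z=(z_1,\dots,z_k)$, $F_n^K(\mathbf z;q)=\sum_{\pi\in LP_n^K}\prod_j z_{\ell_j}\,q^{\mathrm{inv}(\pi)}$, where $\ell_j$ are the layer lengths of $\pi$ and $\mathrm{inv}(\pi)$ is the number of inversions. Conventions: $F_0^K=1$ (empty permutation), $F_n^K=0$ for $n<0$. -}

module Defs where

open import Level using (Level)
open import Data.Nat as ℕ using (ℕ; zero; suc; _∸_; _<?_; _≟_)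
open import Data.Integer as ℤ using (ℤ; +_; -[1+_])
open import Data.List using (List; []; _∷_; _++_; map; concatMap; filter; upTo; length; foldr)
open import Data.Nat.ListAction using (sum)
open import Algebra.Bundles using (CommutativeRing)

lists : ℕ → ℕ → List (List ℕ)
lists zero    K = [] ∷ []
lists (suc r) K = concatMap (λ ℓ → map (ℓ ∷_) (lists r K)) (map suc (upTo K))

-- compositions of n all of whose parts lie in {1,…,K}
-- (a composition of n has at most n parts; lengths 0..n are enumerated once each)
comps : ℕ → ℕ → List (List ℕ)
comps K n = filter (λ c → sum c ≟ n) (concatMap (λ r → lists r K) (upTo (suc n)))

-- the layered permutation (as a word) of [sum c] associated to composition c:
-- first layer = the ℓ largest elements in increasing order, then recurse
layered : List ℕ → List ℕ
layered []      = []
layered (ℓ ∷ c) = map (λ i → suc (sum c ℕ.+ i)) (upTo ℓ) ++ layered c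

inv : List ℕ → ℕ
inv []      = 0
inv (x ∷ w) = length (filter (λ y → y <? x) w) ℕ.+ inv w

module Poly {c ℓ : Level} (R : CommutativeRing c ℓ) where
  open CommutativeRing R public using (Carrier; _≈_; 0#; 1#)
  open CommutativeRing R using (_+_; _*_)

  infixl 6 _⊕_
  infixl 7 _⊗_
  _⊕_ : Carrier → Carrier → Carrier
  _⊕_ = _+_
  _⊗_ : Carrier → Carrier → Carrier
  _⊗_ = _*_

  pow : Carrier → ℕ → Carrier
  pow x zero    = 1#
  pow x (suc e) = x * pow x e

  sumR : List Carrier → Carrier
  sumR = foldr _+_ 0#

  prodR : List Carrier → Carrier
  prodR = foldr _*_ 1#

  -- Σ_{i=a}^{b} f i  (empty if b < a)
  Σ[_⋯_] : ℕ → ℕ → (ℕ → Carrier) → Carrier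
  Σ[ a ⋯ b ] f = sumR (map (λ i → f (a ℕ.+ i)) (upTo (suc b ∸ a)))

  Σ<_ : ℕ → (ℕ → Carrier) → Carrier
  Σ< N = λ f → sumR (map f (upTo N))

  F : (z : ℕ → Carrier) (q : Carrier) (K n : ℕ) → Carrier
  F z q K n = sumR (map (λ c → prodR (map z c) * pow q (inv (layered c))) (comps K n))

  Fℤ : (z : ℕ → Carrier) (q : Carrier) (K : ℕ) → ℤ → Carrier
  Fℤ z q K (+ n)     = F z q K n
  Fℤ z q K -[1+ n ]  = 0#

module Submission where

-- A layered permutation is determined by its composition of layer lengths, and the
-- weight of a composition is multiplicative: a first layer l on top of a composition c
-- contributes z_l · q^(l · sum c) (all its entries exceed the later ones, and a layer
-- is increasing).  Hence w(c ++ d) = q^(sum c · sum d) w(c) w(d).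
--
-- By strong induction on the first argument we prove
--   * the cut identity: a composition of m + n is cut at position m either between
--     two parts (c ++ d) or inside a part i, j units deep (c ++ i ∷ d);
--   * the largest-part identity: a composition with parts ≤ K′+1 either avoids the
--     part K′+1 or splits at its first occurrence.

open import Defs
open import Level using (Level)
open import Data.Nat using (ℕ; suc; _+_; _*_; _∸_; _≤_)
open import Data.Integer using (_⊖_)
open import Data.Product using (_×_)
open import Algebra.Bundles using (CommutativeRing)

open import Data.Nat using (zero; _<_; _<?_; _≟_; _≤?_; z≤n; s≤s)
import Data.Nat.Properties as ℕₚ
open import Data.Integer as ℤ using (ℤ; +_; -[1+_])
import Data.Integer.Properties as ℤₚ
open import Data.List using (List; []; _∷_; _++_; [_]; map; filter; concatMap; upTo; length)
import Data.List.Properties as Listₚ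
open import Data.List.Relation.Unary.All as All using (All; []; _∷_)
import Data.List.Relation.Unary.All.Properties as Allₚ
open import Data.Nat.ListAction using (sum)
open import Data.Nat.ListAction.Properties using (sum-++)
open import Data.Product using (Σ; _,_; proj₁; proj₂)
open import Relation.Binary.PropositionalEquality as ≡ using (_≡_; _≢_; cong; cong₂)
open import Relation.Nullary using (Dec; yes; no; ¬_)
open import Data.Empty using (⊥-elim)
open import Data.Nat.Induction using (<-rec)

below : ℕ → List ℕ → ℕ
below x v = length (filter (λ y → y <? x) v)

below-++ : ∀ x u v → below x (u ++ v) ≡ below x u + below x v
below-++ x u v = ≡.trans (cong length (Listₚ.filter-++ (λ y → y <? x) u v))
                         (Listₚ.length-++ (filter (λ y → y <? x) u))

below-all : ∀ {x} v → All (_< x) v → below x v ≡ length v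
below-all {x} v p = cong length (Listₚ.filter-all (λ y → y <? x) p)

below-none : ∀ {x} v → All (x ≤_) v → below x v ≡ 0
below-none {x} v p = cong length (Listₚ.filter-none (λ y → y <? x) (All.map ℕₚ.≤⇒≯ p))

crossInv : List ℕ → List ℕ → ℕ
crossInv []      v = 0
crossInv (x ∷ u) v = below x v + crossInv u v

inv-++ : ∀ u v → inv (u ++ v) ≡ inv u + inv v + crossInv u v
inv-++ []      v = ≡.sym (ℕₚ.+-identityʳ (inv v))
inv-++ (x ∷ u) v = begin
  below x (u ++ v) + inv (u ++ v)
    ≡⟨ cong₂ _+_ (below-++ x u v) (inv-++ u v) ⟩
  (below x u + below x v) + (inv u + inv v + crossInv u v)
    ≡⟨ regroup (below x u) (below x v) (inv u) (inv v) (crossInv u v) ⟩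
  (below x u + inv u) + inv v + (below x v + crossInv u v) ∎
  where
  open ≡.≡-Reasoning
  open import Data.Nat.Tactic.RingSolver using (solve-∀)
  regroup : ∀ a b d e f → (a + b) + (d + e + f) ≡ (a + d) + e + (b + f)
  regroup = solve-∀

crossInv-all : ∀ u v → All (λ x → All (_< x) v) u → crossInv u v ≡ length u * length v
crossInv-all []      v []       = ≡.refl
crossInv-all (x ∷ u) v (p ∷ ps) = cong₂ _+_ (below-all v p) (crossInv-all u v ps)

crossInv-none : ∀ u v → All (λ x → All (x ≤_) v) u → crossInv u v ≡ 0
crossInv-none []      v []       = ≡.refl
crossInv-none (x ∷ u) v (p ∷ ps) = cong₂ _+_ (below-none v p) (crossInv-none u v ps)

-- The layer of length l placed above s smaller entries: s+1, …, s+l in increasing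
-- order; by definition  layered (l ∷ c) = block (sum c) l ++ layered c.
block : ℕ → ℕ → List ℕ
block s l = map (λ i → suc (s + i)) (upTo l)

block-range : ∀ s l → All (λ x → s < x × x ≤ s + l) (block s l)
block-range s l = Allₚ.map⁺ (Allₚ.applyUpTo⁺₁ (λ i → i) l
  (λ {i} i<l → s≤s (ℕₚ.m≤m+n s i) , ℕₚ.+-monoʳ-< s i<l))

length-block : ∀ s l → length (block s l) ≡ l
length-block s l = ≡.trans (Listₚ.length-map _ (upTo l)) (Listₚ.length-upTo l)

-- A layer is increasing, hence has no inversions.
inv-block : ∀ s l → inv (block s l) ≡ 0
inv-block s zero    = ≡.refl
inv-block s (suc l) = begin
  inv (block s (suc l))
    ≡⟨ cong (λ is → inv (map (λ i → suc (s + i)) is)) (≡.sym (Listₚ.upTo-∷ʳ l)) ⟩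
  inv (map (λ i → suc (s + i)) (upTo l ++ [ l ]))
    ≡⟨ cong inv (Listₚ.map-++ (λ i → suc (s + i)) (upTo l) [ l ]) ⟩
  inv (block s l ++ [ top ])
    ≡⟨ inv-++ (block s l) [ top ] ⟩
  inv (block s l) + 0 + crossInv (block s l) [ top ]
    ≡⟨ cong₂ (λ a b → a + 0 + b) (inv-block s l) (crossInv-none (block s l) [ top ] belowTop) ⟩
  0 ∎
  where
  open ≡.≡-Reasoning
  top = suc (s + l)
  belowTop : All (λ x → All (x ≤_) [ top ]) (block s l)
  belowTop = All.map (λ r → ℕₚ.m≤n⇒m≤1+n (proj₂ r) ∷ []) (block-range s l)

length-layered : ∀ c → length (layered c) ≡ sum c
length-layered []      = ≡.refl
length-layered (l ∷ c) = ≡.trans (Listₚ.length-++ (block (sum c) l))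
                                 (cong₂ _+_ (length-block (sum c) l) (length-layered c))

layered-bounded : ∀ c → All (_≤ sum c) (layered c)
layered-bounded []      = []
layered-bounded (l ∷ c) = Allₚ.++⁺ (All.map (λ r → ℕₚ.≤-trans (proj₂ r) (ℕₚ.≤-reflexive (ℕₚ.+-comm (sum c) l))) (block-range (sum c) l))
                                   (All.map (λ p → ℕₚ.≤-trans p (ℕₚ.m≤n+m (sum c) l)) (layered-bounded c))

-- The first layer l lies above all sum c later entries: it contributes l · sum c inversions.
inv-layered-cons : ∀ l c → inv (layered (l ∷ c)) ≡ l * sum c + inv (layered c)
inv-layered-cons l c = begin
  inv (block (sum c) l ++ layered c)
    ≡⟨ inv-++ (block (sum c) l) (layered c) ⟩
  inv (block (sum c) l) + inv (layered c) + crossInv (block (sum c) l) (layered c)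
    ≡⟨ cong₂ (λ a b → a + inv (layered c) + b) (inv-block (sum c) l) (crossInv-all _ _ aboveRest) ⟩
  inv (layered c) + length (block (sum c) l) * length (layered c)
    ≡⟨ cong₂ (λ a b → inv (layered c) + a * b) (length-block (sum c) l) (length-layered c) ⟩
  inv (layered c) + l * sum c
    ≡⟨ ℕₚ.+-comm (inv (layered c)) (l * sum c) ⟩
  l * sum c + inv (layered c) ∎
  where
  open ≡.≡-Reasoning
  aboveRest : All (λ x → All (_< x) (layered c)) (block (sum c) l)
  aboveRest = All.map (λ r → All.map (λ y≤ → ℕₚ.≤-<-trans y≤ (proj₁ r)) (layered-bounded c)) (block-range (sum c) l)

data Minus (n l : ℕ) : Set where
  fits       : l ≤ n → + n ℤ.- + l ≡ + (n ∸ l) → Minus n l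
  overshoots : n < l → (k : ℕ) → + n ℤ.- + l ≡ -[1+ k ] → Minus n l

sub-fits : ∀ {n l} → l ≤ n → + n ℤ.- + l ≡ + (n ∸ l)
sub-fits {n} {l} l≤n = ≡.trans (ℤₚ.m-n≡m⊖n n l) (ℤₚ.⊖-≥ l≤n)

sub-overshoots : ∀ {n l} → n < l → Σ ℕ (λ k → + n ℤ.- + l ≡ -[1+ k ])
sub-overshoots {n} {l} n<l = l ∸ suc n , ≡.trans (ℤₚ.m-n≡m⊖n n l) (≡.trans (cong (n ⊖_) (≡.sym n+[l-n]≡l)) (⊖-past n (l ∸ suc n)))
  where
  n+[l-n]≡l : n + suc (l ∸ suc n) ≡ l
  n+[l-n]≡l = ≡.trans (ℕₚ.+-suc n (l ∸ suc n)) (ℕₚ.m+[n∸m]≡n n<l)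
  ⊖-past : ∀ n k → n ⊖ (n + suc k) ≡ -[1+ k ]
  ⊖-past zero    k = ≡.refl
  ⊖-past (suc n) k = ≡.trans (ℤₚ.[1+m]⊖[1+n]≡m⊖n n (n + suc k)) (⊖-past n k)

minus : ∀ n l → Minus n l
minus n l with l ≤? n
... | yes l≤n = fits l≤n (sub-fits l≤n)
... | no l≰n  = overshoots n<l (proj₁ (sub-overshoots n<l)) (proj₂ (sub-overshoots n<l))
  where n<l = ℕₚ.≰⇒> l≰n

sub-comm : ∀ x y w → (x ℤ.- y) ℤ.- w ≡ (x ℤ.- w) ℤ.- y
sub-comm x y w = ≡.trans (ℤₚ.+-assoc x (ℤ.- y) (ℤ.- w))
                 (≡.trans (cong (λ v → x ℤ.+ v) (ℤₚ.+-comm (ℤ.- y) (ℤ.- w))) (≡.sym (ℤₚ.+-assoc x (ℤ.- w) (ℤ.- y))))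

sub-sub : ∀ x l l′ → (x ℤ.- + l) ℤ.- + l′ ≡ x ℤ.- + (l + l′)
sub-sub x l l′ = ≡.trans (ℤₚ.+-assoc x (ℤ.- + l) (ℤ.- + l′)) (cong (λ v → x ℤ.+ v) (≡.sym (ℤₚ.neg-distrib-+ (+ l) (+ l′))))

sub-suc : ∀ n l → + suc n ℤ.- + suc l ≡ + n ℤ.- + l
sub-suc n l = ≡.trans (ℤₚ.m-n≡m⊖n (suc n) (suc l)) (≡.trans (ℤₚ.[1+m]⊖[1+n]≡m⊖n n l) (≡.sym (ℤₚ.m-n≡m⊖n n l)))

∸-shrinks : ∀ {n t} → suc t ≤ n → n ∸ suc t < n
∸-shrinks t<n = ℕₚ.∸-monoʳ-< (s≤s z≤n) t<n

sub-nonneg : ∀ n l {s} → + s ≡ + n ℤ.- + l → s ≡ n ∸ l × l ≤ n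
sub-nonneg n l s≡n-l with minus n l
... | fits l≤n e = ℤₚ.+-injective (≡.trans s≡n-l e) , l≤n
... | overshoots _ _ e with ≡.trans s≡n-l e
... | ()

room-for : ∀ n k {j} → j < suc n ∸ k → k + j ≤ n
room-for n k {j} j<N = ℕₚ.≤-trans (ℕₚ.≤-reflexive (ℕₚ.+-comm k j)) (ℕₚ.≤-pred (ℕₚ.m≤o∸n⇒m+n≤o (suc j) k≤1+n j<N))
  where
  k≤1+n : k ≤ suc n
  k≤1+n = ℕₚ.<⇒≤ (ℕₚ.m∸n≢0⇒n<m (λ N≡0 → ℕₚ.n≮0 (≡.subst (j <_) N≡0 j<N)))

restore-part : ∀ n k j → k + j ≤ n → k + (n ∸ k ∸ j) ≡ n ∸ j
restore-part n k j k+j≤n = begin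
  k + (n ∸ k ∸ j)     ≡⟨ cong (λ r → k + r) (ℕₚ.∸-+-assoc n k j) ⟩
  k + (n ∸ (k + j))   ≡⟨ ≡.sym (ℕₚ.+-∸-assoc k k+j≤n) ⟩
  (k + n) ∸ (k + j)   ≡⟨ ℕₚ.[m+n]∸[m+o]≡n∸o k n j ⟩
  n ∸ j               ∎
  where open ≡.≡-Reasoning

module _ {a ℓ : Level} (R : CommutativeRing a ℓ) where
  open Poly R
  open CommutativeRing R
    using ( setoid; refl; reflexive; sym; trans; +-cong; *-cong; +-assoc; +-identityˡ; +-identityʳ
          ; *-assoc; *-identityˡ; zeroˡ; zeroʳ; distribˡ; distribʳ
          ; +-commutativeSemigroup; *-commutativeMonoid )
  open import Algebra.Properties.CommutativeSemigroup +-commutativeSemigroup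
    using (interchange; xy∙z≈x∙zy)
  open import Relation.Binary.Reasoning.Setoid setoid

  sumOver : {A : Set} → List A → (A → Carrier) → Carrier
  sumOver L f = sumR (map f L)

  sumOver-cong : {A : Set} (L : List A) {f g : A → Carrier} → (∀ x → f x ≈ g x) → sumOver L f ≈ sumOver L g
  sumOver-cong []      f≈g = refl
  sumOver-cong (x ∷ L) f≈g = +-cong (f≈g x) (sumOver-cong L f≈g)

  sumOver-zero : {A : Set} (L : List A) {f : A → Carrier} → (∀ x → f x ≈ 0#) → sumOver L f ≈ 0#
  sumOver-zero []      f≈0 = refl
  sumOver-zero (x ∷ L) f≈0 = trans (+-cong (f≈0 x) (sumOver-zero L f≈0)) (+-identityˡ _)

  sumOver-++ : {A : Set} (L L′ : List A) (f : A → Carrier) → sumOver (L ++ L′) f ≈ sumOver L f ⊕ sumOver L′ f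
  sumOver-++ []      L′ f = sym (+-identityˡ _)
  sumOver-++ (x ∷ L) L′ f = trans (+-cong refl (sumOver-++ L L′ f)) (sym (+-assoc _ _ _))

  sumOver-+ : {A : Set} (L : List A) (f g : A → Carrier) → sumOver L (λ x → f x ⊕ g x) ≈ sumOver L f ⊕ sumOver L g
  sumOver-+ []      f g = sym (+-identityˡ _)
  sumOver-+ (x ∷ L) f g = trans (+-cong refl (sumOver-+ L f g)) (interchange _ _ _ _)

  sumOver-*ˡ : {A : Set} (L : List A) (u : Carrier) (f : A → Carrier) → sumOver L (λ x → u ⊗ f x) ≈ u ⊗ sumOver L f
  sumOver-*ˡ []      u f = sym (zeroʳ _)
  sumOver-*ˡ (x ∷ L) u f = trans (+-cong refl (sumOver-*ˡ L u f)) (sym (distribˡ _ _ _))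

  sumOver-*ʳ : {A : Set} (L : List A) (u : Carrier) (f : A → Carrier) → sumOver L (λ x → f x ⊗ u) ≈ sumOver L f ⊗ u
  sumOver-*ʳ []      u f = sym (zeroˡ _)
  sumOver-*ʳ (x ∷ L) u f = trans (+-cong refl (sumOver-*ʳ L u f)) (sym (distribʳ _ _ _))

  sumOver-map : {A B : Set} (L : List A) (g : A → B) (f : B → Carrier) → sumOver (map g L) f ≡ sumOver L (λ x → f (g x))
  sumOver-map []      g f = ≡.refl
  sumOver-map (x ∷ L) g f = cong (f (g x) ⊕_) (sumOver-map L g f)

  sumOver-concatMap : {A B : Set} (L : List A) (h : A → List B) (f : B → Carrier) →
                      sumOver (concatMap h L) f ≈ sumOver L (λ x → sumOver (h x) f)
  sumOver-concatMap []      h f = refl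
  sumOver-concatMap (x ∷ L) h f = trans (sumOver-++ (h x) (concatMap h L) f) (+-cong refl (sumOver-concatMap L h f))

  sumOver-swap : {A B : Set} (L : List A) (L′ : List B) (g : A → B → Carrier) →
                 sumOver L (λ x → sumOver L′ (g x)) ≈ sumOver L′ (λ y → sumOver L (λ x → g x y))
  sumOver-swap []      L′ g = sym (sumOver-zero L′ (λ _ → refl))
  sumOver-swap (x ∷ L) L′ g = trans (+-cong refl (sumOver-swap L L′ g)) (sym (sumOver-+ L′ (g x) _))

  guard : {A : Set} → Dec A → Carrier → Carrier
  guard (yes _) y = y
  guard (no _)  y = 0#

  guard-yes : {A : Set} (y : Carrier) → A → (d : Dec A) → guard d y ≈ y
  guard-yes y p (yes _) = refl
  guard-yes y p (no ¬p) = ⊥-elim (¬p p)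

  guard-no : {A : Set} (y : Carrier) → ¬ A → (d : Dec A) → guard d y ≈ 0#
  guard-no y ¬p (yes p) = ⊥-elim (¬p p)
  guard-no y ¬p (no _)  = refl

  guard-⇔ : {A B : Set} (y : Carrier) → (A → B) → (B → A) → (d : Dec A) (e : Dec B) → guard d y ≈ guard e y
  guard-⇔ y f g (yes p) e = sym (guard-yes y (f p) e)
  guard-⇔ y f g (no ¬p) e = sym (guard-no y (λ q → ¬p (g q)) e)

  sumOver-filter : {A : Set} {P : A → Set} (P? : ∀ x → Dec (P x)) (L : List A) (f : A → Carrier) →
                   sumOver (filter P? L) f ≈ sumOver L (λ x → guard (P? x) (f x))
  sumOver-filter P? []      f = refl
  sumOver-filter P? (x ∷ L) f with P? x
  ... | yes _ = +-cong refl (sumOver-filter P? L f)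
  ... | no _  = trans (sumOver-filter P? L f) (sym (+-identityˡ _))

  upTo-sucˡ : ∀ N (f : ℕ → Carrier) → sumOver (upTo (suc N)) f ≈ f 0 ⊕ sumOver (upTo N) (λ t → f (suc t))
  upTo-sucˡ N f = +-cong refl (reflexive (≡.trans (cong sumR (Listₚ.map-applyUpTo suc f N))
                                                  (≡.sym (cong sumR (Listₚ.map-upTo (λ t → f (suc t)) N)))))

  upTo-sucʳ : ∀ N (f : ℕ → Carrier) → sumOver (upTo (suc N)) f ≈ sumOver (upTo N) f ⊕ f N
  upTo-sucʳ N f = begin
    sumOver (upTo (suc N)) f    ≡⟨ cong (λ L → sumOver L f) (≡.sym (Listₚ.upTo-∷ʳ N)) ⟩
    sumOver (upTo N ++ [ N ]) f ≈⟨ sumOver-++ (upTo N) [ N ] f ⟩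
    sumOver (upTo N) f ⊕ (f N ⊕ 0#) ≈⟨ +-cong refl (+-identityʳ _) ⟩
    sumOver (upTo N) f ⊕ f N    ∎

  upTo-+ : ∀ N N′ (f : ℕ → Carrier) → sumOver (upTo (N + N′)) f ≈ sumOver (upTo N) f ⊕ sumOver (upTo N′) (λ t → f (N + t))
  upTo-+ zero    N′ f = sym (+-identityˡ _)
  upTo-+ (suc N) N′ f = begin
    sumOver (upTo (suc (N + N′))) f
      ≈⟨ upTo-sucˡ (N + N′) f ⟩
    f 0 ⊕ sumOver (upTo (N + N′)) (λ t → f (suc t))
      ≈⟨ +-cong refl (upTo-+ N N′ (λ t → f (suc t))) ⟩
    f 0 ⊕ (sumOver (upTo N) (λ t → f (suc t)) ⊕ sumOver (upTo N′) (λ t → f (suc N + t)))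
      ≈⟨ sym (+-assoc _ _ _) ⟩
    (f 0 ⊕ sumOver (upTo N) (λ t → f (suc t))) ⊕ sumOver (upTo N′) (λ t → f (suc N + t))
      ≈⟨ +-cong (sym (upTo-sucˡ N f)) refl ⟩
    sumOver (upTo (suc N)) f ⊕ sumOver (upTo N′) (λ t → f (suc N + t)) ∎

  upTo-cong : ∀ N {f g : ℕ → Carrier} → (∀ j → j < N → f j ≈ g j) → sumOver (upTo N) f ≈ sumOver (upTo N) g
  upTo-cong zero    f≈g = refl
  upTo-cong (suc N) {f} {g} f≈g = begin
    sumOver (upTo (suc N)) f                    ≈⟨ upTo-sucˡ N f ⟩
    f 0 ⊕ sumOver (upTo N) (λ t → f (suc t))
      ≈⟨ +-cong (f≈g 0 (s≤s z≤n)) (upTo-cong N (λ j j<N → f≈g (suc j) (s≤s j<N))) ⟩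
    g 0 ⊕ sumOver (upTo N) (λ t → g (suc t))    ≈⟨ sym (upTo-sucˡ N g) ⟩
    sumOver (upTo (suc N)) g                    ∎

  upTo-pad : ∀ N N′ (f : ℕ → Carrier) → (∀ j → N ≤ j → f j ≈ 0#) → sumOver (upTo (N + N′)) f ≈ sumOver (upTo N) f
  upTo-pad N N′ f vanish = begin
    sumOver (upTo (N + N′)) f                                   ≈⟨ upTo-+ N N′ f ⟩
    sumOver (upTo N) f ⊕ sumOver (upTo N′) (λ t → f (N + t))
      ≈⟨ +-cong refl (sumOver-zero (upTo N′) (λ t → vanish (N + t) (ℕₚ.m≤m+n N t))) ⟩
    sumOver (upTo N) f ⊕ 0#                                     ≈⟨ +-identityʳ _ ⟩
    sumOver (upTo N) f                                          ∎

  compSum : ℕ → ℤ → (List ℕ → Carrier) → Carrier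
  compSum K (+ n)    f = sumOver (comps K n) f
  compSum K -[1+ _ ] f = 0#

  compSum-cong : ∀ K {x y} {f g : List ℕ → Carrier} → x ≡ y → (∀ c → f c ≈ g c) → compSum K x f ≈ compSum K y g
  compSum-cong K {+ n}      ≡.refl f≈g = sumOver-cong (comps K n) f≈g
  compSum-cong K { -[1+ _ ]} ≡.refl f≈g = refl

  compSum-idx : ∀ K {x y} (f : List ℕ → Carrier) → x ≡ y → compSum K x f ≈ compSum K y f
  compSum-idx K f x≡y = reflexive (cong (λ x → compSum K x f) x≡y)

  compSum-overshoot : ∀ K {n l} f → n < l → compSum K (+ n ℤ.- + l) f ≈ 0#
  compSum-overshoot K f n<l = compSum-idx K f (proj₂ (sub-overshoots n<l))

  compSum-zero : ∀ K x {f : List ℕ → Carrier} → (∀ c → f c ≈ 0#) → compSum K x f ≈ 0#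
  compSum-zero K (+ n)    f≈0 = sumOver-zero (comps K n) f≈0
  compSum-zero K -[1+ _ ] f≈0 = refl

  compSum-supp : ∀ K n {f g : List ℕ → Carrier} → (∀ c → sum c ≡ n → f c ≈ g c) → compSum K (+ n) f ≈ compSum K (+ n) g
  compSum-supp K n {f} {g} f≈g = begin
    sumOver (filter (λ c → sum c ≟ n) L) f         ≈⟨ sumOver-filter (λ c → sum c ≟ n) L f ⟩
    sumOver L (λ c → guard (sum c ≟ n) (f c))      ≈⟨ sumOver-cong L (λ c → onSupport c (sum c ≟ n)) ⟩
    sumOver L (λ c → guard (sum c ≟ n) (g c))      ≈⟨ sym (sumOver-filter (λ c → sum c ≟ n) L g) ⟩
    sumOver (filter (λ c → sum c ≟ n) L) g         ∎
    where
    L = concatMap (λ r → lists r K) (upTo (suc n))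
    onSupport : ∀ c (d : Dec (sum c ≡ n)) → guard d (f c) ≈ guard d (g c)
    onSupport c (yes p) = f≈g c p
    onSupport c (no _)  = refl

  -- y if x = 0, and 0 otherwise: the contribution of the empty composition.
  atZero : ℤ → Carrier → Carrier
  atZero (+ zero)  y = y
  atZero (+ suc _) y = 0#
  atZero -[1+ _ ]  y = 0#

  lengthSum : ℕ → ℕ → ℤ → (List ℕ → Carrier) → Carrier
  lengthSum K r (+ n)    f = sumOver (lists r K) (λ c → guard (sum c ≟ n) (f c))
  lengthSum K r -[1+ _ ] f = 0#

  compSum-byLength : ∀ K n f → compSum K (+ n) f ≈ sumOver (upTo (suc n)) (λ r → lengthSum K r (+ n) f)
  compSum-byLength K n f =
    trans (sumOver-filter (λ c → sum c ≟ n) (concatMap (λ r → lists r K) (upTo (suc n))) f)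
          (sumOver-concatMap (upTo (suc n)) (λ r → lists r K) _)

  lengthSum-zero : ∀ K x f → lengthSum K 0 x f ≈ atZero x (f [])
  lengthSum-zero K (+ zero)  f = trans (+-identityʳ _) (guard-yes (f []) ≡.refl (0 ≟ 0))
  lengthSum-zero K (+ suc n) f = trans (+-identityʳ _) (guard-no (f []) (λ ()) (0 ≟ suc n))
  lengthSum-zero K -[1+ _ ]  f = refl

  lengthSum-suc : ∀ K r x f → lengthSum K (suc r) x f ≈
                  sumOver (upTo K) (λ t → lengthSum K r (x ℤ.- + suc t) (λ c → f (suc t ∷ c)))
  lengthSum-suc K r -[1+ _ ] f = sym (sumOver-zero (upTo K) (λ _ → refl))
  lengthSum-suc K r (+ n) f = begin
    sumOver (concatMap (λ l → map (l ∷_) (lists r K)) (map suc (upTo K))) h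
      ≈⟨ sumOver-concatMap (map suc (upTo K)) _ h ⟩
    sumOver (map suc (upTo K)) (λ l → sumOver (map (l ∷_) (lists r K)) h)
      ≡⟨ sumOver-map (upTo K) suc _ ⟩
    sumOver (upTo K) (λ t → sumOver (map (suc t ∷_) (lists r K)) h)
      ≈⟨ sumOver-cong (upTo K) (λ t → reflexive (sumOver-map (lists r K) (suc t ∷_) h)) ⟩
    sumOver (upTo K) (λ t → sumOver (lists r K) (λ c → h (suc t ∷ c)))
      ≈⟨ sumOver-cong (upTo K) firstPart ⟩
    sumOver (upTo K) (λ t → lengthSum K r (+ n ℤ.- + suc t) (λ c → f (suc t ∷ c))) ∎
    where
    h : List ℕ → Carrier
    h c = guard (sum c ≟ n) (f c)
    firstPart : ∀ t → sumOver (lists r K) (λ c → h (suc t ∷ c)) ≈ lengthSum K r (+ n ℤ.- + suc t) (λ c → f (suc t ∷ c))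
    firstPart t with minus n (suc t)
    ... | fits t<n e = begin
      sumOver (lists r K) (λ c → guard (suc t + sum c ≟ n) (f (suc t ∷ c)))
        ≈⟨ sumOver-cong (lists r K) (λ c → guard-⇔ (f (suc t ∷ c)) (restSum c) (wholeSum c) (suc t + sum c ≟ n) (sum c ≟ n ∸ suc t)) ⟩
      lengthSum K r (+ (n ∸ suc t)) (λ c → f (suc t ∷ c))
        ≡⟨ cong (λ x → lengthSum K r x (λ c → f (suc t ∷ c))) (≡.sym e) ⟩
      lengthSum K r (+ n ℤ.- + suc t) (λ c → f (suc t ∷ c)) ∎
      where
      restSum : ∀ c → suc t + sum c ≡ n → sum c ≡ n ∸ suc t
      restSum c e′ = ≡.trans (≡.sym (ℕₚ.m+n∸m≡n (suc t) (sum c))) (cong (_∸ suc t) e′)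
      wholeSum : ∀ c → sum c ≡ n ∸ suc t → suc t + sum c ≡ n
      wholeSum c e′ = ≡.trans (cong (λ s → suc t + s) e′) (ℕₚ.m+[n∸m]≡n t<n)
    ... | overshoots n<t _ e = begin
      sumOver (lists r K) (λ c → guard (suc t + sum c ≟ n) (f (suc t ∷ c)))
        ≈⟨ sumOver-zero (lists r K) (λ c → guard-no _ (tooBig c) (suc t + sum c ≟ n)) ⟩
      0#
        ≡⟨ cong (λ x → lengthSum K r x (λ c → f (suc t ∷ c))) (≡.sym e) ⟩
      lengthSum K r (+ n ℤ.- + suc t) (λ c → f (suc t ∷ c)) ∎
      where
      tooBig : ∀ c → suc t + sum c ≢ n
      tooBig c e′ = ℕₚ.<⇒≢ (ℕₚ.<-≤-trans n<t (ℕₚ.m≤m+n (suc t) (sum c))) (≡.sym e′)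

  lengthSum-long : ∀ K r n f → n < r → lengthSum K r (+ n) f ≈ 0#
  lengthSum-long K (suc r) n f n<r = trans (lengthSum-suc K r (+ n) f) (sumOver-zero (upTo K) rest)
    where
    rest : ∀ t → lengthSum K r (+ n ℤ.- + suc t) (λ c → f (suc t ∷ c)) ≈ 0#
    rest t with minus n (suc t)
    ... | fits t<n e = trans (reflexive (cong (λ x → lengthSum K r x (λ c → f (suc t ∷ c))) e))
                             (lengthSum-long K r (n ∸ suc t) _ (ℕₚ.<-≤-trans (∸-shrinks t<n) (ℕₚ.≤-pred n<r)))
    ... | overshoots _ _ e = reflexive (cong (λ x → lengthSum K r x (λ c → f (suc t ∷ c))) e)

  compSum-byLength′ : ∀ K n M f → n < M → compSum K (+ n) f ≈ sumOver (upTo M) (λ r → lengthSum K r (+ n) f)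
  compSum-byLength′ K n M f n<M = begin
    compSum K (+ n) f                                        ≈⟨ compSum-byLength K n f ⟩
    sumOver (upTo (suc n)) byLen                             ≈⟨ sym (upTo-pad (suc n) (M ∸ suc n) byLen (λ r → lengthSum-long K r n f)) ⟩
    sumOver (upTo (suc n + (M ∸ suc n))) byLen               ≡⟨ cong (λ N → sumOver (upTo N) byLen) (ℕₚ.m+[n∸m]≡n n<M) ⟩
    sumOver (upTo M) byLen                                   ∎
    where
    byLen : ℕ → Carrier
    byLen r = lengthSum K r (+ n) f

  compSum-first : ∀ K x f → compSum K x f ≈
                  atZero x (f []) ⊕ sumOver (upTo K) (λ t → compSum K (x ℤ.- + suc t) (λ c → f (suc t ∷ c)))
  compSum-first K -[1+ _ ] f = sym (trans (+-identityˡ _) (sumOver-zero (upTo K) (λ _ → refl)))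
  compSum-first K (+ n) f = begin
    compSum K (+ n) f
      ≈⟨ compSum-byLength′ K n (suc (suc n)) f (ℕₚ.m≤n⇒m≤1+n (ℕₚ.n<1+n n)) ⟩
    sumOver (upTo (suc (suc n))) (λ r → lengthSum K r (+ n) f)
      ≈⟨ upTo-sucˡ (suc n) _ ⟩
    lengthSum K 0 (+ n) f ⊕ sumOver (upTo (suc n)) (λ r → lengthSum K (suc r) (+ n) f)
      ≈⟨ +-cong (lengthSum-zero K (+ n) f) (sumOver-cong (upTo (suc n)) (λ r → lengthSum-suc K r (+ n) f)) ⟩
    atZero (+ n) (f []) ⊕ sumOver (upTo (suc n)) (λ r → sumOver (upTo K) (λ t → lengthSum K r (+ n ℤ.- + suc t) (g t)))
      ≈⟨ +-cong refl (sumOver-swap (upTo (suc n)) (upTo K) _) ⟩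
    atZero (+ n) (f []) ⊕ sumOver (upTo K) (λ t → sumOver (upTo (suc n)) (λ r → lengthSum K r (+ n ℤ.- + suc t) (g t)))
      ≈⟨ +-cong refl (sumOver-cong (upTo K) byLength⁻¹) ⟩
    atZero (+ n) (f []) ⊕ sumOver (upTo K) (λ t → compSum K (+ n ℤ.- + suc t) (g t)) ∎
    where
    g : ℕ → List ℕ → Carrier
    g t c = f (suc t ∷ c)
    byLength⁻¹ : ∀ t → sumOver (upTo (suc n)) (λ r → lengthSum K r (+ n ℤ.- + suc t) (g t)) ≈ compSum K (+ n ℤ.- + suc t) (g t)
    byLength⁻¹ t with minus n (suc t)
    ... | fits t<n e = begin
      sumOver (upTo (suc n)) (λ r → lengthSum K r (+ n ℤ.- + suc t) (g t))
        ≡⟨ cong (λ x → sumOver (upTo (suc n)) (λ r → lengthSum K r x (g t))) e ⟩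
      sumOver (upTo (suc n)) (λ r → lengthSum K r (+ (n ∸ suc t)) (g t))
        ≈⟨ sym (compSum-byLength′ K (n ∸ suc t) (suc n) (g t) (s≤s (ℕₚ.m∸n≤m n (suc t)))) ⟩
      compSum K (+ (n ∸ suc t)) (g t)
        ≡⟨ cong (λ x → compSum K x (g t)) (≡.sym e) ⟩
      compSum K (+ n ℤ.- + suc t) (g t) ∎
    ... | overshoots _ _ e = begin
      sumOver (upTo (suc n)) (λ r → lengthSum K r (+ n ℤ.- + suc t) (g t))
        ≡⟨ cong (λ x → sumOver (upTo (suc n)) (λ r → lengthSum K r x (g t))) e ⟩
      sumOver (upTo (suc n)) (λ r → 0#)
        ≈⟨ sumOver-zero (upTo (suc n)) (λ _ → refl) ⟩
      0#
        ≡⟨ cong (λ x → compSum K x (g t)) (≡.sym e) ⟩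
      compSum K (+ n ℤ.- + suc t) (g t) ∎

  Σ⋯-cong : ∀ lo hi {f g : ℕ → Carrier} → (∀ i → f i ≈ g i) → Σ[ lo ⋯ hi ] f ≈ Σ[ lo ⋯ hi ] g
  Σ⋯-cong lo hi f≈g = sumOver-cong (upTo (suc hi ∸ lo)) (λ i → f≈g (lo + i))

  Σ⋯-+ : ∀ lo hi (f g : ℕ → Carrier) → Σ[ lo ⋯ hi ] (λ i → f i ⊕ g i) ≈ Σ[ lo ⋯ hi ] f ⊕ Σ[ lo ⋯ hi ] g
  Σ⋯-+ lo hi f g = sumOver-+ (upTo (suc hi ∸ lo)) (λ i → f (lo + i)) (λ i → g (lo + i))

  Σ⋯-swap : ∀ lo hi N (g : ℕ → ℕ → Carrier) →
            Σ[ lo ⋯ hi ] (λ i → sumOver (upTo N) (g i)) ≈ sumOver (upTo N) (λ t → Σ[ lo ⋯ hi ] (λ i → g i t))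
  Σ⋯-swap lo hi N g = sumOver-swap (upTo (suc hi ∸ lo)) (upTo N) (λ i → g (lo + i))

  -- Cutting compositions of x + n at position x.  Either the cut falls between two
  -- parts, giving a composition c of x followed by a composition d of n ...
  concatSum : ℕ → ℤ → ℕ → (List ℕ → Carrier) → Carrier
  concatSum K x n f = compSum K x (λ c → compSum K (+ n) (λ d → f (c ++ d)))

  -- ... or it falls j ∈ {1,…,i-1} units into a part i ∈ {2,…,K}: the composition is
  -- c ++ i ∷ d with c a composition of x - j and d one of n + j - i.
  straddleSum : ℕ → ℤ → ℕ → (List ℕ → Carrier) → Carrier
  straddleSum K x n f = Σ[ 2 ⋯ K ] (λ i → Σ[ 1 ⋯ i ∸ 1 ] (λ j →
    compSum K (x ℤ.- + j) (λ c → compSum K ((n + j) ⊖ i) (λ d → f (c ++ i ∷ d)))))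

  cutSum : ℕ → ℤ → ℕ → (List ℕ → Carrier) → Carrier
  cutSum K x n f = concatSum K x n f ⊕ straddleSum K x n f

  -- The terms of straddleSum with c = [], i.e. where the first part straddles the cut.
  straddleHead : ℕ → ℤ → ℕ → (List ℕ → Carrier) → Carrier
  straddleHead K x n f = Σ[ 2 ⋯ K ] (λ i → Σ[ 1 ⋯ i ∸ 1 ] (λ j →
    atZero (x ℤ.- + j) (compSum K ((n + j) ⊖ i) (λ d → f (i ∷ d)))))

  cutSum-neg : ∀ K k n f → cutSum K -[1+ k ] n f ≈ 0#
  cutSum-neg K k n f = trans (+-identityˡ _) (sumOver-zero (upTo (suc K ∸ 2)) (λ i → sumOver-zero (upTo (suc i)) (λ j → refl)))

  straddleSum-first : ∀ K x n f → straddleSum K x n f ≈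
    straddleHead K x n f ⊕ sumOver (upTo K) (λ t → straddleSum K (x ℤ.- + suc t) n (λ c → f (suc t ∷ c)))
  straddleSum-first K x n f = begin
    straddleSum K x n f
      ≈⟨ Σ⋯-cong 2 K (λ i → Σ⋯-cong 1 (i ∸ 1) (λ j → compSum-first K (x ℤ.- + j) (inner i j))) ⟩
    Σ[ 2 ⋯ K ] (λ i → Σ[ 1 ⋯ i ∸ 1 ] (λ j → head i j ⊕ sumOver (upTo K) (tail i j)))
      ≈⟨ Σ⋯-cong 2 K (λ i → Σ⋯-+ 1 (i ∸ 1) (head i) (λ j → sumOver (upTo K) (tail i j))) ⟩
    Σ[ 2 ⋯ K ] (λ i → Σ[ 1 ⋯ i ∸ 1 ] (head i) ⊕ Σ[ 1 ⋯ i ∸ 1 ] (λ j → sumOver (upTo K) (tail i j)))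
      ≈⟨ Σ⋯-+ 2 K (λ i → Σ[ 1 ⋯ i ∸ 1 ] (head i)) (λ i → Σ[ 1 ⋯ i ∸ 1 ] (λ j → sumOver (upTo K) (tail i j))) ⟩
    straddleHead K x n f ⊕ Σ[ 2 ⋯ K ] (λ i → Σ[ 1 ⋯ i ∸ 1 ] (λ j → sumOver (upTo K) (tail i j)))
      ≈⟨ +-cong refl (trans (Σ⋯-cong 2 K (λ i → Σ⋯-swap 1 (i ∸ 1) K (tail i))) (Σ⋯-swap 2 K K (λ i t → Σ[ 1 ⋯ i ∸ 1 ] (λ j → tail i j t)))) ⟩
    straddleHead K x n f ⊕ sumOver (upTo K) (λ t → Σ[ 2 ⋯ K ] (λ i → Σ[ 1 ⋯ i ∸ 1 ] (λ j → tail i j t)))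
      ≈⟨ +-cong refl (sumOver-cong (upTo K) (λ t → Σ⋯-cong 2 K (λ i → Σ⋯-cong 1 (i ∸ 1) (λ j →
           compSum-idx K (λ c → inner i j (suc t ∷ c)) (sub-comm x (+ j) (+ suc t)))))) ⟩
    straddleHead K x n f ⊕ sumOver (upTo K) (λ t → straddleSum K (x ℤ.- + suc t) n (λ c → f (suc t ∷ c))) ∎
    where
    inner : ℕ → ℕ → List ℕ → Carrier
    inner i j c = compSum K ((n + j) ⊖ i) (λ d → f (c ++ i ∷ d))
    head : ℕ → ℕ → Carrier
    head i j = atZero (x ℤ.- + j) (inner i j [])
    tail : ℕ → ℕ → ℕ → Carrier
    tail i j t = compSum K ((x ℤ.- + j) ℤ.- + suc t) (λ c → inner i j (suc t ∷ c))

  cutSum-first : ∀ K x n f → cutSum K x n f ≈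
    (atZero x (compSum K (+ n) f) ⊕ straddleHead K x n f)
    ⊕ sumOver (upTo K) (λ t → cutSum K (x ℤ.- + suc t) n (λ c → f (suc t ∷ c)))
  cutSum-first K x n f = begin
    concatSum K x n f ⊕ straddleSum K x n f
      ≈⟨ +-cong (compSum-first K x (λ c → compSum K (+ n) (λ d → f (c ++ d)))) (straddleSum-first K x n f) ⟩
    (atZero x (compSum K (+ n) f) ⊕ sumOver (upTo K) concatRest) ⊕ (straddleHead K x n f ⊕ sumOver (upTo K) straddleRest)
      ≈⟨ interchange _ _ _ _ ⟩
    (atZero x (compSum K (+ n) f) ⊕ straddleHead K x n f) ⊕ (sumOver (upTo K) concatRest ⊕ sumOver (upTo K) straddleRest)
      ≈⟨ +-cong refl (sym (sumOver-+ (upTo K) concatRest straddleRest)) ⟩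
    (atZero x (compSum K (+ n) f) ⊕ straddleHead K x n f) ⊕ sumOver (upTo K) (λ t → cutSum K (x ℤ.- + suc t) n (λ c → f (suc t ∷ c))) ∎
    where
    concatRest straddleRest : ℕ → Carrier
    concatRest t   = concatSum K (x ℤ.- + suc t) n (λ c → f (suc t ∷ c))
    straddleRest t = straddleSum K (x ℤ.- + suc t) n (λ c → f (suc t ∷ c))

  atZero-pick : ∀ N m (φ : ℕ → Carrier) →
    sumOver (upTo N) (λ t → atZero (+ suc m ℤ.- + suc t) (φ (suc t))) ≈ guard (suc m ≤? N) (φ (suc m))
  atZero-pick zero    m       φ = sym (guard-no (φ (suc m)) (λ ()) (suc m ≤? 0))
  atZero-pick (suc N) zero    φ = begin
    sumOver (upTo (suc N)) (λ t → atZero (+ 1 ℤ.- + suc t) (φ (suc t)))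
      ≈⟨ upTo-sucˡ N _ ⟩
    φ 1 ⊕ sumOver (upTo N) (λ t → atZero (+ 1 ℤ.- + suc (suc t)) (φ (suc (suc t))))
      ≈⟨ +-cong refl (sumOver-zero (upTo N) (λ _ → refl)) ⟩
    φ 1 ⊕ 0#                 ≈⟨ +-identityʳ _ ⟩
    φ 1                      ≈⟨ sym (guard-yes (φ 1) (s≤s z≤n) (1 ≤? suc N)) ⟩
    guard (1 ≤? suc N) (φ 1) ∎
  atZero-pick (suc N) (suc m) φ = begin
    sumOver (upTo (suc N)) (λ t → atZero (+ suc (suc m) ℤ.- + suc t) (φ (suc t)))
      ≈⟨ upTo-sucˡ N _ ⟩
    0# ⊕ sumOver (upTo N) (λ t → atZero (+ suc (suc m) ℤ.- + suc (suc t)) (φ (suc (suc t))))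
      ≈⟨ +-identityˡ _ ⟩
    sumOver (upTo N) (λ t → atZero (+ suc (suc m) ℤ.- + suc (suc t)) (φ (suc (suc t))))
      ≈⟨ sumOver-cong (upTo N) (λ t → reflexive (cong (λ y → atZero y (φ (suc (suc t)))) (sub-suc (suc m) (suc t)))) ⟩
    sumOver (upTo N) (λ t → atZero (+ suc m ℤ.- + suc t) (φ (suc (suc t))))
      ≈⟨ atZero-pick N m (λ j → φ (suc j)) ⟩
    guard (suc m ≤? N) (φ (suc (suc m)))
      ≈⟨ guard-⇔ _ s≤s ℕₚ.≤-pred (suc m ≤? N) (suc (suc m) ≤? suc N) ⟩
    guard (suc (suc m) ≤? suc N) (φ (suc (suc m))) ∎

  -- At a positive cut m the first part t+1 straddles it exactly when m ≤ t, and then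
  -- the cut falls j = m units into that part.
  straddleHead-pick : ∀ K′ m′ n f → straddleHead (suc K′) (+ suc m′) n f ≈
    sumOver (upTo (suc K′)) (λ t → guard (suc m′ ≤? t) (compSum (suc K′) ((n + suc m′) ⊖ suc t) (λ d → f (suc t ∷ d))))
  straddleHead-pick K′ m′ n f = begin
    straddleHead K (+ m) n f
      ≈⟨ sumOver-cong (upTo K′) (λ i → atZero-pick (suc i) m′ (λ j → compSum K ((n + j) ⊖ (2 + i)) (λ d → f (2 + i ∷ d)))) ⟩
    sumOver (upTo K′) (λ i → straddling (suc i))
      ≈⟨ sym (+-identityˡ _) ⟩
    0# ⊕ sumOver (upTo K′) (λ i → straddling (suc i))
      ≈⟨ +-cong (sym (guard-no (compSum K ((n + m) ⊖ 1) (λ d → f (1 ∷ d))) (λ ()) (m ≤? 0))) refl ⟩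
    straddling 0 ⊕ sumOver (upTo K′) (λ i → straddling (suc i))
      ≈⟨ sym (upTo-sucˡ K′ straddling) ⟩
    sumOver (upTo K) straddling ∎
    where
    K = suc K′
    m = suc m′
    straddling : ℕ → Carrier
    straddling t = guard (m ≤? t) (compSum K ((n + m) ⊖ suc t) (λ d → f (suc t ∷ d)))

  cutSum-zero : ∀ K n f → cutSum K (+ 0) n f ≈ compSum K (+ n) f
  cutSum-zero K n f = begin
    concatSum K (+ 0) n f ⊕ straddleSum K (+ 0) n f
      ≈⟨ +-cong (compSum-first K (+ 0) (λ c → compSum K (+ n) (λ d → f (c ++ d)))) noStraddle ⟩
    (compSum K (+ n) f ⊕ sumOver (upTo K) (λ _ → 0#)) ⊕ 0#
      ≈⟨ trans (+-identityʳ _) (+-cong refl (sumOver-zero (upTo K) (λ _ → refl))) ⟩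
    compSum K (+ n) f ⊕ 0#
      ≈⟨ +-identityʳ _ ⟩
    compSum K (+ n) f ∎
    where
    noStraddle : straddleSum K (+ 0) n f ≈ 0#
    noStraddle = sumOver-zero (upTo (suc K ∸ 2)) (λ i → sumOver-zero (upTo (suc i)) (λ _ → refl))

  cut-identity : ∀ K′ m n f → compSum (suc K′) (+ (m + n)) f ≈ cutSum (suc K′) (+ m) n f
  cut-identity K′ = <-rec (λ m → ∀ n f → compSum K (+ (m + n)) f ≈ cutSum K (+ m) n f) step
    where
    K = suc K′
    step : ∀ m → (∀ {m″} → m″ < m → ∀ n f → compSum K (+ (m″ + n)) f ≈ cutSum K (+ m″) n f) →
           ∀ n f → compSum K (+ (m + n)) f ≈ cutSum K (+ m) n f
    step zero     _  n f = sym (cutSum-zero K n f)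
    step (suc m′) IH n f = begin
      compSum K (+ (m + n)) f                               ≈⟨ compSum-first K (+ (m + n)) f ⟩
      0# ⊕ sumOver (upTo K) later                           ≈⟨ +-identityˡ _ ⟩
      sumOver (upTo K) later                                ≈⟨ sumOver-cong (upTo K) splitFirst ⟩
      sumOver (upTo K) (λ t → straddling t ⊕ rest t)        ≈⟨ sumOver-+ (upTo K) straddling rest ⟩
      sumOver (upTo K) straddling ⊕ sumOver (upTo K) rest   ≈⟨ +-cong (sym (straddleHead-pick K′ m′ n f)) refl ⟩
      straddleHead K (+ m) n f ⊕ sumOver (upTo K) rest      ≈⟨ +-cong (sym (+-identityˡ _)) refl ⟩
      (0# ⊕ straddleHead K (+ m) n f) ⊕ sumOver (upTo K) rest ≈⟨ sym (cutSum-first K (+ m) n f) ⟩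
      cutSum K (+ m) n f                                    ∎
      where
      m = suc m′
      g : ℕ → List ℕ → Carrier
      g t c = f (suc t ∷ c)
      later straddling rest : ℕ → Carrier
      later t      = compSum K (+ (m + n) ℤ.- + suc t) (g t)
      straddling t = guard (m ≤? t) (compSum K ((n + m) ⊖ suc t) (g t))
      rest t       = cutSum K (+ m ℤ.- + suc t) n (g t)
      -- the first part t+1 either ends before the cut (induction) or straddles it
      splitFirst : ∀ t → later t ≈ straddling t ⊕ rest t
      splitFirst t with minus m (suc t)
      ... | fits t<m e = begin
        later t
          ≈⟨ compSum-idx K (g t) (≡.trans (sub-fits (ℕₚ.≤-trans t<m (ℕₚ.m≤m+n m n))) (cong +_ (ℕₚ.+-∸-comm n t<m))) ⟩
        compSum K (+ ((m ∸ suc t) + n)) (g t)   ≈⟨ IH (∸-shrinks t<m) n (g t) ⟩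
        cutSum K (+ (m ∸ suc t)) n (g t)        ≡⟨ cong (λ x → cutSum K x n (g t)) (≡.sym e) ⟩
        rest t                                  ≈⟨ sym (+-identityˡ _) ⟩
        0# ⊕ rest t                             ≈⟨ +-cong (sym (guard-no _ (ℕₚ.<⇒≱ t<m) (m ≤? t))) refl ⟩
        straddling t ⊕ rest t                   ∎
      ... | overshoots m<t k e = begin
        later t
          ≈⟨ compSum-idx K (g t) (≡.trans (ℤₚ.m-n≡m⊖n (m + n) (suc t)) (cong (_⊖ suc t) (ℕₚ.+-comm m n))) ⟩
        compSum K ((n + m) ⊖ suc t) (g t)       ≈⟨ sym (guard-yes _ (ℕₚ.≤-pred m<t) (m ≤? t)) ⟩
        straddling t                            ≈⟨ sym (+-identityʳ _) ⟩
        straddling t ⊕ 0#                       ≈⟨ +-cong refl (sym (trans (reflexive (cong (λ x → cutSum K x n (g t)) e)) (cutSum-neg K k n (g t)))) ⟩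
        straddling t ⊕ rest t                   ∎

  -- Compositions of x (parts ≤ K = K′+1) containing a part K, split at its first
  -- occurrence: c (parts ≤ K′) of some j < M, then K, then d (parts ≤ K) of x - K - j.
  firstKSum : ℕ → ℕ → ℤ → (List ℕ → Carrier) → Carrier
  firstKSum K′ M x f = sumOver (upTo M) (λ j → compSum K′ (+ j) (λ c →
    compSum (suc K′) ((x ℤ.- + suc K′) ℤ.- + j) (λ d → f (c ++ suc K′ ∷ d))))

  firstKSum-neg : ∀ K′ M k f → firstKSum K′ M -[1+ k ] f ≈ 0#
  firstKSum-neg K′ M k f = sumOver-zero (upTo M) (λ j → compSum-zero K′ (+ j) (λ c → belowZero j))
    where
    belowZero : ∀ j {g : List ℕ → Carrier} → compSum (suc K′) ((-[1+ k ] ℤ.- + suc K′) ℤ.- + j) g ≈ 0#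
    belowZero zero    = refl
    belowZero (suc j) = refl

  -- Reindexing the parts c that start with t+1: they are the j ≥ t+1 terms, shifted.
  firstKSum-shift : ∀ K′ M n (f : List ℕ → Carrier) t → n < suc K′ + M →
    sumOver (upTo M) (λ j → compSum K′ (+ j ℤ.- + suc t) (λ c →
      compSum (suc K′) ((+ n ℤ.- + suc K′) ℤ.- + j) (λ d → f (suc t ∷ c ++ suc K′ ∷ d))))
    ≈ firstKSum K′ M (+ n ℤ.- + suc t) (λ c → f (suc t ∷ c))
  firstKSum-shift K′ M n f t n<K+M = begin
    sumOver (upTo M) b                                  ≈⟨ sym (upTo-pad M l b beyondM) ⟩
    sumOver (upTo (M + l)) b                            ≡⟨ cong (λ N → sumOver (upTo N) b) (ℕₚ.+-comm M l) ⟩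
    sumOver (upTo (l + M)) b                            ≈⟨ upTo-+ l M b ⟩
    sumOver (upTo l) b ⊕ sumOver (upTo M) (λ j → b (l + j))
      ≈⟨ +-cong (trans (upTo-cong l (λ j j<l → compSum-overshoot K′ _ j<l)) (sumOver-zero (upTo l) (λ _ → refl))) refl ⟩
    0# ⊕ sumOver (upTo M) (λ j → b (l + j))             ≈⟨ +-identityˡ _ ⟩
    sumOver (upTo M) (λ j → b (l + j))                  ≈⟨ sumOver-cong (upTo M) reindex ⟩
    firstKSum K′ M (+ n ℤ.- + l) (λ c → f (l ∷ c))     ∎
    where
    K = suc K′
    l = suc t
    b : ℕ → Carrier
    b j = compSum K′ (+ j ℤ.- + l) (λ c → compSum K ((+ n ℤ.- + K) ℤ.- + j) (λ d → f (l ∷ c ++ K ∷ d)))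
    beyondM : ∀ j → M ≤ j → b j ≈ 0#
    beyondM j M≤j = compSum-zero K′ (+ j ℤ.- + l) (λ c →
      trans (compSum-idx K _ (sub-sub (+ n) K j)) (compSum-overshoot K _ (ℕₚ.<-≤-trans n<K+M (ℕₚ.+-monoʳ-≤ K M≤j))))
    reindex : ∀ j → b (l + j) ≈ compSum K′ (+ j) (λ c → compSum K (((+ n ℤ.- + l) ℤ.- + K) ℤ.- + j) (λ d → f (l ∷ c ++ K ∷ d)))
    reindex j = compSum-cong K′ (≡.trans (sub-fits (ℕₚ.m≤m+n l j)) (cong +_ (ℕₚ.m+n∸m≡n l j)))
                  (λ c → compSum-idx K _ (≡.trans (sub-sub (+ n) K (l + j)) (≡.trans (cong (λ s → + n ℤ.- + s) (swapParts K l j))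
                                         (≡.sym (≡.trans (sub-sub (+ n ℤ.- + l) K j) (sub-sub (+ n) l (K + j)))))))
      where
      swapParts : ∀ u v w → u + (v + w) ≡ v + (u + w)
      swapParts u v w = ≡.trans (≡.sym (ℕₚ.+-assoc u v w)) (≡.trans (cong (_+ w) (ℕₚ.+-comm u v)) (ℕₚ.+-assoc v u w))

  firstKSum-first : ∀ K′ M n (f : List ℕ → Carrier) → n < suc K′ + M →
    firstKSum K′ M (+ n) f ≈ compSum (suc K′) (+ n ℤ.- + suc K′) (λ d → f (suc K′ ∷ d))
                            ⊕ sumOver (upTo K′) (λ t → firstKSum K′ M (+ n ℤ.- + suc t) (λ c → f (suc t ∷ c)))
  firstKSum-first K′ M n f n<K+M = begin
    sumOver (upTo M) (λ j → compSum K′ (+ j) (h j))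
      ≈⟨ sumOver-cong (upTo M) (λ j → compSum-first K′ (+ j) (h j)) ⟩
    sumOver (upTo M) (λ j → atZero (+ j) (h j []) ⊕ sumOver (upTo K′) (rest j))
      ≈⟨ sumOver-+ (upTo M) (λ j → atZero (+ j) (h j [])) (λ j → sumOver (upTo K′) (rest j)) ⟩
    sumOver (upTo M) (λ j → atZero (+ j) (h j [])) ⊕ sumOver (upTo M) (λ j → sumOver (upTo K′) (rest j))
      ≈⟨ +-cong (emptyC M n<K+M) (sumOver-swap (upTo M) (upTo K′) rest) ⟩
    compSum K (+ n ℤ.- + K) (λ d → f (K ∷ d)) ⊕ sumOver (upTo K′) (λ t → sumOver (upTo M) (λ j → rest j t))
      ≈⟨ +-cong refl (sumOver-cong (upTo K′) (λ t → firstKSum-shift K′ M n f t n<K+M)) ⟩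
    compSum K (+ n ℤ.- + K) (λ d → f (K ∷ d)) ⊕ sumOver (upTo K′) (λ t → firstKSum K′ M (+ n ℤ.- + suc t) (λ c → f (suc t ∷ c))) ∎
    where
    K = suc K′
    h : ℕ → List ℕ → Carrier
    h j c = compSum K ((+ n ℤ.- + K) ℤ.- + j) (λ d → f (c ++ K ∷ d))
    rest : ℕ → ℕ → Carrier
    rest j t = compSum K′ (+ j ℤ.- + suc t) (λ c → h j (suc t ∷ c))
    -- c = [] forces j = 0
    emptyC : ∀ M → n < K + M → sumOver (upTo M) (λ j → atZero (+ j) (h j [])) ≈ compSum K (+ n ℤ.- + K) (λ d → f (K ∷ d))
    emptyC zero     n<K = sym (compSum-overshoot K _ (ℕₚ.<-≤-trans n<K (ℕₚ.≤-reflexive (ℕₚ.+-identityʳ K))))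
    emptyC (suc M′) _   = begin
      sumOver (upTo (suc M′)) (λ j → atZero (+ j) (h j []))
        ≈⟨ upTo-sucˡ M′ _ ⟩
      h 0 [] ⊕ sumOver (upTo M′) (λ _ → 0#)
        ≈⟨ trans (+-cong refl (sumOver-zero (upTo M′) (λ _ → refl))) (+-identityʳ _) ⟩
      h 0 []
        ≈⟨ compSum-idx K (λ d → f (K ∷ d)) (ℤₚ.+-identityʳ (+ n ℤ.- + K)) ⟩
      compSum K (+ n ℤ.- + K) (λ d → f (K ∷ d)) ∎

  largest-identity : ∀ K′ M n (f : List ℕ → Carrier) → n < suc K′ + M →
    compSum (suc K′) (+ n) f ≈ compSum K′ (+ n) f ⊕ firstKSum K′ M (+ n) f
  largest-identity K′ M = <-rec (λ n → ∀ f → n < K + M → compSum K (+ n) f ≈ compSum K′ (+ n) f ⊕ firstKSum K′ M (+ n) f) step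
    where
    K = suc K′
    step : ∀ n → (∀ {n′} → n′ < n → ∀ f → n′ < K + M → compSum K (+ n′) f ≈ compSum K′ (+ n′) f ⊕ firstKSum K′ M (+ n′) f) →
           ∀ f → n < K + M → compSum K (+ n) f ≈ compSum K′ (+ n) f ⊕ firstKSum K′ M (+ n) f
    step n IH f n<K+M = begin
      compSum K (+ n) f
        ≈⟨ compSum-first K (+ n) f ⟩
      atZero (+ n) (f []) ⊕ sumOver (upTo K) later
        ≈⟨ +-cong refl (upTo-sucʳ K′ later) ⟩
      atZero (+ n) (f []) ⊕ (sumOver (upTo K′) later ⊕ later K′)
        ≈⟨ +-cong refl (+-cong (trans (sumOver-cong (upTo K′) splitFirst) (sumOver-+ (upTo K′) small withK)) refl) ⟩
      atZero (+ n) (f []) ⊕ ((sumOver (upTo K′) small ⊕ sumOver (upTo K′) withK) ⊕ later K′)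
        ≈⟨ trans (+-cong refl (xy∙z≈x∙zy _ _ _)) (sym (+-assoc _ _ _)) ⟩
      (atZero (+ n) (f []) ⊕ sumOver (upTo K′) small) ⊕ (later K′ ⊕ sumOver (upTo K′) withK)
        ≈⟨ +-cong (sym (compSum-first K′ (+ n) f)) (sym (firstKSum-first K′ M n f n<K+M)) ⟩
      compSum K′ (+ n) f ⊕ firstKSum K′ M (+ n) f ∎
      where
      g : ℕ → List ℕ → Carrier
      g t c = f (suc t ∷ c)
      later small withK : ℕ → Carrier
      later t = compSum K (+ n ℤ.- + suc t) (g t)
      small t = compSum K′ (+ n ℤ.- + suc t) (g t)
      withK t = firstKSum K′ M (+ n ℤ.- + suc t) (g t)
      splitFirst : ∀ t → later t ≈ small t ⊕ withK t
      splitFirst t with minus n (suc t)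
      ... | fits t<n e = begin
        later t                                                  ≡⟨ cong (λ x → compSum K x (g t)) e ⟩
        compSum K (+ (n ∸ suc t)) (g t)
          ≈⟨ IH (∸-shrinks t<n) (g t) (ℕₚ.≤-<-trans (ℕₚ.m∸n≤m n (suc t)) n<K+M) ⟩
        compSum K′ (+ (n ∸ suc t)) (g t) ⊕ firstKSum K′ M (+ (n ∸ suc t)) (g t)
          ≡⟨ cong (λ x → compSum K′ x (g t) ⊕ firstKSum K′ M x (g t)) (≡.sym e) ⟩
        small t ⊕ withK t                                        ∎
      ... | overshoots _ k e = begin
        later t                                       ≡⟨ cong (λ x → compSum K x (g t)) e ⟩
        0#                                            ≈⟨ sym (+-identityˡ _) ⟩
        0# ⊕ 0#                                       ≈⟨ +-cong refl (sym (firstKSum-neg K′ M k (g t))) ⟩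
        compSum K′ -[1+ k ] (g t) ⊕ firstKSum K′ M -[1+ k ] (g t) ≡⟨ cong (λ x → compSum K′ x (g t) ⊕ firstKSum K′ M x (g t)) (≡.sym e) ⟩
        small t ⊕ withK t                             ∎

  pow-+ : ∀ x e e′ → pow x (e + e′) ≈ pow x e ⊗ pow x e′
  pow-+ x zero    e′ = sym (*-identityˡ _)
  pow-+ x (suc e) e′ = trans (*-cong refl (pow-+ x e e′)) (sym (*-assoc _ _ _))

  module _ (z : ℕ → Carrier) (q : Carrier) where
    open import Algebra.Solver.CommutativeMonoid *-commutativeMonoid
      renaming (_⊕_ to _·_)
      using (solve; _⊜_)

    weight : List ℕ → Carrier
    weight c = prodR (map z c) ⊗ pow q (inv (layered c))

    weight-cons : ∀ l c → weight (l ∷ c) ≈ (z l ⊗ pow q (l * sum c)) ⊗ weight c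
    weight-cons l c = begin
      (z l ⊗ prodR (map z c)) ⊗ pow q (inv (layered (l ∷ c)))
        ≡⟨ cong (λ e → (z l ⊗ prodR (map z c)) ⊗ pow q e) (inv-layered-cons l c) ⟩
      (z l ⊗ prodR (map z c)) ⊗ pow q (l * sum c + inv (layered c))
        ≈⟨ *-cong refl (pow-+ q (l * sum c) (inv (layered c))) ⟩
      (z l ⊗ prodR (map z c)) ⊗ (pow q (l * sum c) ⊗ pow q (inv (layered c)))
        ≈⟨ solve 4 (λ u v w x → (u · v) · (w · x) ⊜ (u · w) · (v · x)) refl
                 (z l) (prodR (map z c)) (pow q (l * sum c)) (pow q (inv (layered c))) ⟩
      (z l ⊗ pow q (l * sum c)) ⊗ weight c ∎

    -- Concatenation: every entry of c's layers lies above every entry of d's.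
    weight-++ : ∀ c d → weight (c ++ d) ≈ (pow q (sum c * sum d) ⊗ weight c) ⊗ weight d
    weight-++ []      d = sym (trans (*-cong (trans (*-identityˡ _) (*-identityˡ _)) refl) (*-identityˡ _))
    weight-++ (l ∷ c) d = begin
      weight (l ∷ (c ++ d))
        ≈⟨ weight-cons l (c ++ d) ⟩
      (z l ⊗ pow q (l * sum (c ++ d))) ⊗ weight (c ++ d)
        ≈⟨ *-cong (*-cong refl splitExp) (weight-++ c d) ⟩
      (z l ⊗ (pow q (l * sum c) ⊗ pow q (l * sum d))) ⊗ ((pow q (sum c * sum d) ⊗ weight c) ⊗ weight d)
        ≈⟨ solve 6 (λ u v v′ w x y → (u · (v · v′)) · ((w · x) · y) ⊜ ((v′ · w) · ((u · v) · x)) · y) refl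
                 (z l) (pow q (l * sum c)) (pow q (l * sum d)) (pow q (sum c * sum d)) (weight c) (weight d) ⟩
      ((pow q (l * sum d) ⊗ pow q (sum c * sum d)) ⊗ ((z l ⊗ pow q (l * sum c)) ⊗ weight c)) ⊗ weight d
        ≈⟨ *-cong (*-cong joinExp (sym (weight-cons l c))) refl ⟩
      (pow q ((l + sum c) * sum d) ⊗ weight (l ∷ c)) ⊗ weight d ∎
      where
      splitExp : pow q (l * sum (c ++ d)) ≈ pow q (l * sum c) ⊗ pow q (l * sum d)
      splitExp = trans (reflexive (cong (λ e → pow q (l * e)) (sum-++ c d)))
                       (trans (reflexive (cong (pow q) (ℕₚ.*-distribˡ-+ l (sum c) (sum d)))) (pow-+ q (l * sum c) (l * sum d)))
      joinExp : pow q (l * sum d) ⊗ pow q (sum c * sum d) ≈ pow q ((l + sum c) * sum d)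
      joinExp = sym (trans (reflexive (cong (pow q) (ℕₚ.*-distribʳ-+ (sum d) l (sum c)))) (pow-+ q (l * sum d) (sum c * sum d)))

    weight-straddle : ∀ c i d {s t u} → sum c ≡ s → sum d ≡ t → i + t ≡ u →
      weight (c ++ i ∷ d) ≈ (((z i ⊗ pow q (i * t)) ⊗ pow q (s * u)) ⊗ weight c) ⊗ weight d
    weight-straddle c i d ≡.refl ≡.refl ≡.refl = begin
      weight (c ++ i ∷ d)
        ≈⟨ weight-++ c (i ∷ d) ⟩
      (pow q (sum c * (i + sum d)) ⊗ weight c) ⊗ weight (i ∷ d)
        ≈⟨ *-cong refl (weight-cons i d) ⟩
      (pow q (sum c * (i + sum d)) ⊗ weight c) ⊗ ((z i ⊗ pow q (i * sum d)) ⊗ weight d)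
        ≈⟨ solve 5 (λ u x w v y → (u · x) · ((w · v) · y) ⊜ (((w · v) · u) · x) · y) refl
                 (pow q (sum c * (i + sum d))) (weight c) (z i) (pow q (i * sum d)) (weight d) ⟩
      (((z i ⊗ pow q (i * sum d)) ⊗ pow q (sum c * (i + sum d))) ⊗ weight c) ⊗ weight d ∎

    -- A double sum whose summand factors through the weights is a product of F's; a
    -- negative index empties the sum and kills the corresponding factor.
    compSum-product : ∀ K K′ x y (C : Carrier) (h : List ℕ → List ℕ → Carrier) →
      (∀ c d → + sum c ≡ x → + sum d ≡ y → h c d ≈ (C ⊗ weight c) ⊗ weight d) →
      compSum K x (λ c → compSum K′ y (h c)) ≈ C ⊗ Fℤ z q K x ⊗ Fℤ z q K′ y
    compSum-product K K′ -[1+ _ ] y C h factors = sym (trans (*-cong (zeroʳ C) refl) (zeroˡ _))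
    compSum-product K K′ (+ a) -[1+ _ ] C h factors = trans (sumOver-zero (comps K a) (λ _ → refl)) (sym (zeroʳ _))
    compSum-product K K′ (+ a) (+ b) C h factors = begin
      compSum K (+ a) (λ c → compSum K′ (+ b) (h c))
        ≈⟨ compSum-supp K a (λ c ca → trans (compSum-supp K′ b (λ d db → factors c d (cong +_ ca) (cong +_ db)))
                                           (sumOver-*ˡ (comps K′ b) (C ⊗ weight c) weight)) ⟩
      sumOver (comps K a) (λ c → (C ⊗ weight c) ⊗ F z q K′ b)
        ≈⟨ sumOver-*ʳ (comps K a) (F z q K′ b) (λ c → C ⊗ weight c) ⟩
      sumOver (comps K a) (λ c → C ⊗ weight c) ⊗ F z q K′ b
        ≈⟨ *-cong (sumOver-*ˡ (comps K a) C weight) refl ⟩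
      C ⊗ F z q K a ⊗ F z q K′ b ∎

  -- First recurrence: cut the layered permutations of [m+n] at position m.
  cutRecurrence : (z : ℕ → Carrier) (q : Carrier) (k′ m n : ℕ) →
    F z q (suc k′) (m + n) ≈
      (pow q (m * n) ⊗ F z q (suc k′) m ⊗ F z q (suc k′) n)
      ⊕ Σ[ 2 ⋯ suc k′ ] (λ i → Σ[ 1 ⋯ i ∸ 1 ] (λ j →
          z i ⊗ pow q (i * (n + j ∸ i)) ⊗ pow q ((m ∸ j) * (n + j))
              ⊗ Fℤ z q (suc k′) (m ⊖ j) ⊗ Fℤ z q (suc k′) ((n + j) ⊖ i)))
  cutRecurrence z q k′ m n =
    trans (cut-identity k′ m n (weight z q))
          (+-cong concatTerm (Σ⋯-cong 2 k (λ i → Σ⋯-cong 1 (i ∸ 1) (straddleTerm i))))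
    where
    k = suc k′
    concatTerm : concatSum k (+ m) n (weight z q) ≈ pow q (m * n) ⊗ F z q k m ⊗ F z q k n
    concatTerm = compSum-product z q k k (+ m) (+ n) (pow q (m * n)) (λ c d → weight z q (c ++ d))
      (λ c d c≡m d≡n → trans (weight-++ z q c d)
         (reflexive (cong₂ (λ s t → (pow q (s * t) ⊗ weight z q c) ⊗ weight z q d) (ℤₚ.+-injective c≡m) (ℤₚ.+-injective d≡n))))
    straddleTerm : ∀ i j →
      compSum k (+ m ℤ.- + j) (λ c → compSum k ((n + j) ⊖ i) (λ d → weight z q (c ++ i ∷ d))) ≈
      z i ⊗ pow q (i * (n + j ∸ i)) ⊗ pow q ((m ∸ j) * (n + j)) ⊗ Fℤ z q k (m ⊖ j) ⊗ Fℤ z q k ((n + j) ⊖ i)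
    straddleTerm i j =
      trans (compSum-product z q k k (+ m ℤ.- + j) ((n + j) ⊖ i) C (λ c d → weight z q (c ++ i ∷ d)) factors)
            (reflexive (cong (λ x → C ⊗ Fℤ z q k x ⊗ Fℤ z q k ((n + j) ⊖ i)) (ℤₚ.m-n≡m⊖n m j)))
      where
      C = z i ⊗ pow q (i * (n + j ∸ i)) ⊗ pow q ((m ∸ j) * (n + j))
      factors : ∀ c d → + sum c ≡ + m ℤ.- + j → + sum d ≡ (n + j) ⊖ i →
                weight z q (c ++ i ∷ d) ≈ (C ⊗ weight z q c) ⊗ weight z q d
      factors c d c≡ d≡ with sub-nonneg m j c≡ | sub-nonneg (n + j) i (≡.trans d≡ (≡.sym (ℤₚ.m-n≡m⊖n (n + j) i)))
      ... | c≡m-j , _ | d≡n+j-i , i≤n+j = weight-straddle z q c i d c≡m-j d≡n+j-i (ℕₚ.m+[n∸m]≡n i≤n+j)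

  -- Second recurrence: split off the first occurrence of the largest allowed part k.
  largestPartRecurrence : (z : ℕ → Carrier) (q : Carrier) (k′ n : ℕ) →
    F z q (suc k′) n ≈
      F z q k′ n
      ⊕ (Σ< (suc n ∸ suc k′)) (λ j →
          z (suc k′) ⊗ pow q (suc k′ * (n ∸ suc k′ ∸ j)) ⊗ pow q (j * (n ∸ j))
              ⊗ F z q k′ j ⊗ F z q (suc k′) (n ∸ suc k′ ∸ j))
  largestPartRecurrence z q k′ n =
    trans (largest-identity k′ (suc n ∸ k) n (weight z q) (ℕₚ.m≤n+m∸n (suc n) k))
          (+-cong refl (upTo-cong (suc n ∸ k) splitAtK))
    where
    k = suc k′
    splitAtK : ∀ j → j < suc n ∸ k →
      compSum k′ (+ j) (λ c → compSum k ((+ n ℤ.- + k) ℤ.- + j) (λ d → weight z q (c ++ k ∷ d))) ≈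
      z k ⊗ pow q (k * (n ∸ k ∸ j)) ⊗ pow q (j * (n ∸ j)) ⊗ F z q k′ j ⊗ F z q k (n ∸ k ∸ j)
    splitAtK j j<N =
      trans (compSum-cong k′ {x = + j} ≡.refl (λ c → compSum-idx k (λ d → weight z q (c ++ k ∷ d)) rest≡))
            (compSum-product z q k′ k (+ j) (+ (n ∸ k ∸ j)) C (λ c d → weight z q (c ++ k ∷ d)) factors)
      where
      C = z k ⊗ pow q (k * (n ∸ k ∸ j)) ⊗ pow q (j * (n ∸ j))
      k+j≤n = room-for n k j<N
      rest≡ : (+ n ℤ.- + k) ℤ.- + j ≡ + (n ∸ k ∸ j)
      rest≡ = ≡.trans (sub-sub (+ n) k j) (≡.trans (sub-fits k+j≤n) (cong +_ (≡.sym (ℕₚ.∸-+-assoc n k j))))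
      factors : ∀ c d → + sum c ≡ + j → + sum d ≡ + (n ∸ k ∸ j) →
                weight z q (c ++ k ∷ d) ≈ (C ⊗ weight z q c) ⊗ weight z q d
      factors c d c≡ d≡ = weight-straddle z q c k d (ℤₚ.+-injective c≡) (ℤₚ.+-injective d≡) (restore-part n k j k+j≤n)

mainTheorem7 : {c ℓ : Level} (R : CommutativeRing c ℓ) →
    let open Poly R
    in (z : ℕ → Carrier) (q : Carrier) (k : ℕ) → 1 ≤ k →
    ((m n : ℕ) → 1 ≤ m → 1 ≤ n →
    F z q k (m + n) ≈
    (pow q (m * n) ⊗ F z q k m ⊗ F z q k n)
    ⊕ Σ[ 2 ⋯ k ] (λ i → Σ[ 1 ⋯ i ∸ 1 ] (λ j →
    z i ⊗ pow q (i * (n + j ∸ i)) ⊗ pow q ((m ∸ j) * (n + j))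
    ⊗ Fℤ z q k (m ⊖ j) ⊗ Fℤ z q k ((n + j) ⊖ i))))
    × ((n : ℕ) → 1 ≤ n →
    F z q k n ≈
    F z q (k ∸ 1) n
    ⊕ (Σ< (suc n ∸ k)) (λ j →
    z k ⊗ pow q (k * (n ∸ k ∸ j)) ⊗ pow q (j * (n ∸ j))
    ⊗ F z q (k ∸ 1) j ⊗ F z q k (n ∸ k ∸ j)))
mainTheorem7 R z q (suc k′) _ =
  (λ m n _ _ → cutRecurrence R z q k′ m n) , (λ n _ → largestPartRecurrence R z q k′ n)
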